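{- Let $p\ge4$, $k\ge p$ and let $M^p_k=(T_1,\dots,T_p)$ be the network on registers $1,\dots,N$ defined in the context. Let the initial content of the registers be a sequence $x\in\{0,1\}^N$ that is 2-sorted (i.e. $(x_1,x_3,\dots,x_{N-1})$ and $(x_2,x_4,\dots,x_N)$ are both non-decreasing). Then after every stage of the repeated application $T_1,\dots,T_p,T_1,\dots,T_p,\dots$ (any number of stages), for every $t=1,\dots,b$ the content of the column $C_t=\{t+lb:0\le l\le n-1\}$, read in increasing order of register index, is of the form $0^*1^*$.
   Context: A comparator $[u:v]$ with $u<v$ puts the minimum of the contents of registers $u,v$ into $u$ and the maximum into $v$; a stage applies a set of comparators on pairwise disjoint register pairs simultaneously. Fix $p\ge 4$, $k\ge p$, $n=2^{k-1}-1$, $b=2\lceil\frac{k-2}{p-2}\rceil$, $N=nb$, $D=k-1+\frac b2$. Define: - $S_1=\{[bi:bi+1]: 1\le i\le n-1\}$; - for $1\le j\le b/2$ and integer $s$ with $(p-2)(j-1)<s\le\min((p-2)j,k-1)$: $S_{j+s}=\{[bi+j:\ b(i+2^{k-s-1}-1)+b-j+1]: 0\le i\le n-2^{k-s-1}\}$; - for integer $j$ with $1\le j\le\frac{k-2}{p-2}$: $S_{(p-1)j+1}=\{[bi+j:bi+j+1],[bi+b-j:bi+b-j+1]:0\le i\le n-1\}$. For $x=1,\dots,p$, $T_x=\bigcup\{S_{x+pi}: i\ge0,\ x+pi\le D\}$ (a stage). -}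

module Defs where

open import Data.Nat using (ℕ; zero; suc; _+_; _*_; _∸_; _^_; _≤_; _<_; _≡ᵇ_; _≤ᵇ_; _<ᵇ_)
open import Data.Nat.DivMod using (_/_; _%_)
open import Data.Bool using (Bool; true; false; if_then_else_; _∧_; _∨_)
open import Data.List using (List; []; _∷_; _++_; map; concatMap; upTo; foldl)
open import Relation.Binary.PropositionalEquality using (_≡_)
open import Data.Product using (_×_; _,_; ∃-syntax)

-- p - 2, written as suc (p ∸ 3) so that it is syntactically nonzero;
-- equals p - 2 whenever p ≥ 3.
pm2 : ℕ → ℕ
pm2 p = suc (p ∸ 3)

nN : ℕ → ℕ
nN k = 2 ^ (k ∸ 1) ∸ 1

-- ⌈ a / (p-2) ⌉ = (a + (p-2) - 1) / (p-2)
ceilDiv : ℕ → ℕ → ℕ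
ceilDiv a p = (a + (p ∸ 3)) / pm2 p

bB : ℕ → ℕ → ℕ
bB p k = 2 * ceilDiv (k ∸ 2) p

NN : ℕ → ℕ → ℕ
NN p k = nN k * bB p k

DD : ℕ → ℕ → ℕ
DD p k = (k ∸ 1) + bB p k / 2

range : ℕ → ℕ → List ℕ
range a c = map (a +_) (upTo (suc c ∸ a))

Comparator : Set
Comparator = ℕ × ℕ

-- The comparator set S_d (empty if no clause of the definition applies).
S : ℕ → ℕ → ℕ → List Comparator
S p k d = part1 ++ (part2 ++ part3)
  where
  n = nN k
  b = bB p k
  part1 : List Comparator
  part1 = if d ≡ᵇ 1 then map (λ i → (b * i , b * i + 1)) (range 1 (n ∸ 1)) else []
  part2 : List Comparator
  part2 = concatMap (λ j → concatMap (λ s →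
            if (pm2 p * (j ∸ 1) <ᵇ s) ∧ (s ≤ᵇ pm2 p * j) ∧ (s ≤ᵇ k ∸ 1) ∧ ((j + s) ≡ᵇ d)
            then map (λ i → (b * i + j , b * (i + 2 ^ (k ∸ s ∸ 1) ∸ 1) + b ∸ j + 1))
                     (range 0 (n ∸ 2 ^ (k ∸ s ∸ 1)))
            else [])
            (range 1 (k ∸ 1)))
          (range 1 (b / 2))
  -- S_{(p-1)j+1} for 1 ≤ j ≤ (k-2)/(p-2), i.e. (p-2) j ≤ k-2
  part3 : List Comparator
  part3 = concatMap (λ j →
            if (pm2 p * j ≤ᵇ k ∸ 2) ∧ (((p ∸ 1) * j + 1) ≡ᵇ d)
            then concatMap (λ i → (b * i + j , b * i + j + 1) ∷ (b * i + b ∸ j , b * i + b ∸ j + 1) ∷ [])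
                   (range 0 (n ∸ 1))
            else [])
          (range 1 k)

stageT : ℕ → ℕ → ℕ → List Comparator
stageT p k x = concatMap (λ i → if (x + p * i) ≤ᵇ DD p k then S p k (x + p * i) else [])
                 (range 0 (DD p k))

-- Register contents: register r holds x r (only 1..N are relevant).
Contents : Set
Contents = ℕ → Bool

-- Apply one comparator [u:v]: min (∧ on Bool) into u, max (∨) into v.
applyComp : Contents → Comparator → Contents
applyComp x (u , v) r =
  if r ≡ᵇ u then x u ∧ x v else if r ≡ᵇ v then x u ∨ x v else x r

-- Apply a stage (comparators on pairwise disjoint pairs, so sequential
-- application equals simultaneous application).
applyStage : List Comparator → Contents → Contents
applyStage cs x = foldl applyComp x cs

-- Index (in 1..p) of the T used at stage number m+1 of the repeated sequence
-- T_1,...,T_p,T_1,...,T_p,...  (i.e. (m mod p) + 1).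
cyc : ℕ → ℕ → ℕ
cyc p zero = 1
cyc p (suc m) = if cyc p m ≡ᵇ p then 1 else suc (cyc p m)

run : ℕ → ℕ → ℕ → Contents → Contents
run p k zero x = x
run p k (suc m) x = applyStage (stageT p k (cyc p m)) (run p k m x)

TwoSorted : ℕ → Contents → Set
TwoSorted N x =
  (∀ a c → a ≤ c → 2 * c + 1 ≤ N → x (2 * a + 1) Data.Bool.≤ x (2 * c + 1)) ×
  (∀ a c → a ≤ c → 2 * c + 2 ≤ N → x (2 * a + 2) Data.Bool.≤ x (2 * c + 2))

ColumnZerosOnes : ℕ → ℕ → Contents → ℕ → Set
ColumnZerosOnes n b y t =
  ∃[ c ] (c ≤ n ×
    (∀ l → l < n → (l < c → y (t + l * b) ≡ false)
                 × (c ≤ l → y (t + l * b) ≡ true)))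

module Submission where

-- Read the registers as an n × b array: register t + l b lies in row l of column t.
-- The invariant is that every column is sorted.  It holds initially because b is even,
-- so each column is a subsequence of one parity class of the 2-sorted input.  Every S_d
-- is a union of complete ladders: for columns A ≠ B and an offset δ, all comparators
-- joining row i of A to row i + δ of B with i + δ < n.  A complete ladder replaces
-- column A by the rowwise minimum of A and B shifted up by δ, and B by the rowwise
-- maximum of B and A shifted down by δ; both are again sorted, and other columns are
-- untouched.  Finally, a sorted 0/1 sequence has the form 0*1*.

open import Defs
open import Data.Bool using (Bool; true; false; _∧_; _∨_; if_then_else_; T; b≤b) renaming (_≤_ to _≤ᴮ_)
open import Data.Bool.Properties using (T-∧; ≤-minimum; ≤-maximum) renaming (≤-refl to ≤ᴮ-refl; ≤-trans to ≤ᴮ-trans)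
open import Data.Empty using (⊥-elim)
open import Data.List using (List; []; _∷_; _++_; foldl; concatMap; map; upTo)
open import Data.List.Properties using (foldl-++)
open import Data.List.Membership.Propositional using (_∈_; find; lose)
open import Data.List.Membership.Propositional.Properties using (∈-map⁺; ∈-map⁻; ∈-upTo⁺; ∈-upTo⁻; ∈-++⁺ˡ; ∈-++⁺ʳ; ∈-++⁻; ∈-concatMap⁺; ∈-concatMap⁻)
import Data.List.Membership.DecPropositional as DecMembership
open import Data.List.Relation.Unary.Any using (Any; here; there; any?)
open import Data.Nat using (ℕ; zero; suc; _+_; _*_; _∸_; _^_; _/_; _<_; _≤_; z≤n; s≤s; s≤s⁻¹; s<s⁻¹; _<?_; _≤?_; _≟_; _≡ᵇ_; _≤ᵇ_)
open import Data.Nat.Properties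
open import Data.Nat.DivMod using (_%_; [m+kn]%n≡m%n; m<n⇒m%n≡m; m*n/n≡m; /-monoˡ-≤; m≥n⇒m/n>0)
open import Data.Nat.Tactic.RingSolver using (solve-∀)
open import Data.Product using (_×_; _,_; proj₁; proj₂; ∃-syntax)
open import Data.Product.Properties using (≡-dec; ,-injectiveˡ; ,-injectiveʳ)
open import Data.Sum using (_⊎_; inj₁; inj₂; [_,_]′)
open import Function using (_∘_; id; _⇔_; Equivalence; mk⇔)
open import Relation.Binary.PropositionalEquality
open import Relation.Nullary using (Dec; yes; no)
open import Relation.Nullary.Decidable using (dec-true; dec-false; _⊎-dec_)

open Equivalence using (to; from)
open DecMembership (≡-dec _≟_ _≟_) using (_∈?_)

∧-mono-≤ : ∀ {a a' b b'} → a ≤ᴮ a' → b ≤ᴮ b' → a ∧ b ≤ᴮ a' ∧ b'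
∧-mono-≤ {false} _   _ = ≤-minimum _
∧-mono-≤ {true}  b≤b q = q

∨-mono-≤ : ∀ {a a' b b'} → a ≤ᴮ a' → b ≤ᴮ b' → a ∨ b ≤ᴮ a' ∨ b'
∨-mono-≤ {a' = true}  _   _ = ≤-maximum _
∨-mono-≤ {a' = false} b≤b q = q

a∧b≤a : ∀ a b → a ∧ b ≤ᴮ a
a∧b≤a false _ = b≤b
a∧b≤a true  b = ≤-maximum b

b≤a∨b : ∀ a b → b ≤ᴮ a ∨ b
b≤a∨b false b = ≤ᴮ-refl
b≤a∨b true  b = ≤-maximum b

Sorted : ℕ → (ℕ → Bool) → Set
Sorted n f = ∀ l → suc l < n → f l ≤ᴮ f (suc l)

≤ᴮ-resp-≡ : ∀ {a b c d} → a ≡ b → c ≡ d → b ≤ᴮ d → a ≤ᴮ c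
≤ᴮ-resp-≡ refl refl q = q

Sorted-cong : ∀ {n f g} → (∀ l → l < n → f l ≡ g l) → Sorted n f → Sorted n g
Sorted-cong f≡g sf l sl<n = ≤ᴮ-resp-≡ (sym (f≡g l (<-trans (n<1+n l) sl<n))) (sym (f≡g (suc l) sl<n)) (sf l sl<n)

sorted-min-shift : ∀ {n δ f g h} → Sorted n f → Sorted n g →
  (∀ l → l + δ < n → h l ≡ f l ∧ g (l + δ)) →
  (∀ l → l < n → n ≤ l + δ → h l ≡ f l) →
  Sorted n h
sorted-min-shift {n} {δ} {f} {g} sf sg hmin hf l sl<n with suc l + δ <? n | l + δ <? n
... | yes sl+δ<n | _ = ≤ᴮ-resp-≡ (hmin l (<-trans (n<1+n _) sl+δ<n)) (hmin (suc l) sl+δ<n)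
                        (∧-mono-≤ (sf l sl<n) (sg (l + δ) sl+δ<n))
... | no sl+δ≮n | yes l+δ<n = ≤ᴮ-resp-≡ (hmin l l+δ<n) (hf (suc l) sl<n (≮⇒≥ sl+δ≮n))
                        (≤ᴮ-trans (a∧b≤a (f l) (g (l + δ))) (sf l sl<n))
... | no sl+δ≮n | no l+δ≮n = ≤ᴮ-resp-≡ (hf l (<-trans (n<1+n l) sl<n) (≮⇒≥ l+δ≮n)) (hf (suc l) sl<n (≮⇒≥ sl+δ≮n))
                        (sf l sl<n)

sorted-max-shift : ∀ {n δ f g h} → Sorted n f → Sorted n g →
  (∀ i → i + δ < n → h (i + δ) ≡ f i ∨ g (i + δ)) →
  (∀ l → l < δ → l < n → h l ≡ g l) →
  Sorted n h
sorted-max-shift {n} {δ} {f} {g} {h} sf sg hmax hg l sl<n with δ ≤? l | δ ≤? suc l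
... | yes δ≤l | _ = subst (λ l → h l ≤ᴮ h (suc l)) (m∸n+n≡m δ≤l) above
  where
  i = l ∸ δ
  si+δ<n : suc i + δ < n
  si+δ<n = subst (λ m → suc m < n) (sym (m∸n+n≡m δ≤l)) sl<n
  above : h (i + δ) ≤ᴮ h (suc i + δ)
  above = ≤ᴮ-resp-≡ (hmax i (<-trans (n<1+n _) si+δ<n)) (hmax (suc i) si+δ<n)
            (∨-mono-≤ (sf i (≤-<-trans (s≤s (m≤m+n _ δ)) si+δ<n)) (sg (i + δ) si+δ<n))
... | no δ≰l | yes δ≤sl = ≤ᴮ-resp-≡ (hg l (≰⇒> δ≰l) (<-trans (n<1+n l) sl<n)) crossing
                            (≤ᴮ-trans (sg l sl<n) (b≤a∨b (f 0) (g (suc l))))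
  where
  crossing : h (suc l) ≡ f 0 ∨ g (suc l)
  crossing = subst (λ m → h m ≡ f 0 ∨ g m) δ≡sl (hmax 0 (subst (_< n) (sym δ≡sl) sl<n))
    where
    δ≡sl : δ ≡ suc l
    δ≡sl = ≤-antisym δ≤sl (≰⇒> δ≰l)
... | no δ≰l | no δ≰sl = ≤ᴮ-resp-≡ (hg l (≰⇒> δ≰l) (<-trans (n<1+n l) sl<n)) (hg (suc l) (≰⇒> δ≰sl) sl<n) (sg l sl<n)

true≤⇒≡true : ∀ {b} → true ≤ᴮ b → b ≡ true
true≤⇒≡true b≤b = refl

sorted⇒zeros-then-ones : ∀ n f → Sorted n f →
  ∃[ c ] (c ≤ n × (∀ l → l < n → (l < c → f l ≡ false) × (c ≤ l → f l ≡ true)))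
sorted⇒zeros-then-ones zero    f sf = 0 , z≤n , λ _ ()
sorted⇒zeros-then-ones (suc n) f sf with f 0 in f0
... | true = 0 , z≤n , λ l l<1+n → (λ ()) , (λ _ → ones l l<1+n)
  where
  ones : ∀ l → l < suc n → f l ≡ true
  ones zero    _      = f0
  ones (suc l) sl<1+n = true≤⇒≡true (subst (_≤ᴮ f (suc l)) (ones l (<-trans (n<1+n l) sl<1+n)) (sf l sl<1+n))
... | false with sorted⇒zeros-then-ones n (f ∘ suc) (λ l sl<n → sf (suc l) (s≤s sl<n))
...   | c , c≤n , cut = suc c , s≤s c≤n , shifted
  where
  shifted : ∀ l → l < suc n → (l < suc c → f l ≡ false) × (suc c ≤ l → f l ≡ true)
  shifted zero    _          = (λ _ → f0) , λ ()
  shifted (suc l) (s≤s l<n) with cut l l<n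
  ... | zeros , ones = zeros ∘ s<s⁻¹ , ones ∘ s≤s⁻¹

Disjoint : Comparator → Comparator → Set
Disjoint (u , v) (u' , v') = (u ≢ u') × (u ≢ v') × (v ≢ u') × (v ≢ v')

Disjoint-sym : ∀ {c c'} → Disjoint c c' → Disjoint c' c
Disjoint-sym (d₁ , d₂ , d₃ , d₄) = (d₁ ∘ sym) , (d₃ ∘ sym) , (d₂ ∘ sym) , (d₄ ∘ sym)

record Parallel (cs : List Comparator) : Set where
  field
    distinct-ends     : ∀ {u v} → (u , v) ∈ cs → u ≢ v
    equal-or-disjoint : ∀ {c c'} → c ∈ cs → c' ∈ cs → c ≡ c' ⊎ Disjoint c c'
open Parallel

Parallel-∷⁻ : ∀ {c cs} → Parallel (c ∷ cs) → Parallel cs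
Parallel-∷⁻ P = record
  { distinct-ends     = distinct-ends P ∘ there
  ; equal-or-disjoint = λ m m' → equal-or-disjoint P (there m) (there m')
  }

Parallel-⇔ : ∀ {cs ds} → (∀ {c} → c ∈ cs ⇔ c ∈ ds) → Parallel cs → Parallel ds
Parallel-⇔ cs⇔ds P = record
  { distinct-ends     = distinct-ends P ∘ from cs⇔ds
  ; equal-or-disjoint = λ m m' → equal-or-disjoint P (from cs⇔ds m) (from cs⇔ds m')
  }

Untouched : List Comparator → ℕ → Set
Untouched cs r = ∀ {u v} → (u , v) ∈ cs → (r ≢ u) × (r ≢ v)

applyComp-min : ∀ x u v → applyComp x (u , v) u ≡ x u ∧ x v
applyComp-min x u v rewrite dec-true (u ≟ u) refl = refl

applyComp-max : ∀ x {u v} → u ≢ v → applyComp x (u , v) v ≡ x u ∨ x v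
applyComp-max x {u} {v} u≢v rewrite dec-false (v ≟ u) (u≢v ∘ sym) | dec-true (v ≟ v) refl = refl

applyComp-other : ∀ x {u v r} → r ≢ u → r ≢ v → applyComp x (u , v) r ≡ x r
applyComp-other x {u} {v} {r} r≢u r≢v rewrite dec-false (r ≟ u) r≢u | dec-false (r ≟ v) r≢v = refl

record ParallelEffect (x : Contents) (cs : List Comparator) (z : Contents) : Set where
  field
    at-min    : ∀ {u v} → (u , v) ∈ cs → z u ≡ x u ∧ x v
    at-max    : ∀ {u v} → (u , v) ∈ cs → z v ≡ x u ∨ x v
    elsewhere : ∀ {r} → Untouched cs r → z r ≡ x r
open ParallelEffect

[a∧b]∧[a∨b]≡a∧b : ∀ a b → (a ∧ b) ∧ (a ∨ b) ≡ a ∧ b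
[a∧b]∧[a∨b]≡a∧b false b     = refl
[a∧b]∧[a∨b]≡a∧b true  false = refl
[a∧b]∧[a∨b]≡a∧b true  true  = refl

[a∧b]∨[a∨b]≡a∨b : ∀ a b → (a ∧ b) ∨ (a ∨ b) ≡ a ∨ b
[a∧b]∨[a∨b]≡a∨b false b     = refl
[a∧b]∨[a∨b]≡a∨b true  false = refl
[a∧b]∨[a∨b]≡a∨b true  true  = refl

repeated-or-untouched : ∀ {u v cs} → Parallel ((u , v) ∷ cs) →
                        (u , v) ∈ cs ⊎ (Untouched cs u × Untouched cs v)
repeated-or-untouched {u} {v} {cs} P with (u , v) ∈? cs
... | yes m = inj₁ m
... | no ∉ = inj₂ ( (λ m → let (d₁ , d₂ , _ , _) = disjoint m in d₁ , d₂)
                 , (λ m → let (_ , _ , d₃ , d₄) = disjoint m in d₃ , d₄) )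
  where
  disjoint : ∀ {c} → c ∈ cs → Disjoint (u , v) c
  disjoint m with equal-or-disjoint P (here refl) (there m)
  ... | inj₁ refl = ⊥-elim (∉ m)
  ... | inj₂ d    = d

foldl-parallel : ∀ cs x → Parallel cs → ParallelEffect x cs (foldl applyComp x cs)
foldl-parallel []             x P = record { at-min = λ () ; at-max = λ () ; elsewhere = λ _ → refl }
foldl-parallel ((u , v) ∷ cs) x P = record { at-min = min-case ; at-max = max-case ; elsewhere = other }
  where
  x' : Contents
  x' = applyComp x (u , v)
  IH : ParallelEffect x' cs (foldl applyComp x' cs)
  IH = foldl-parallel cs x' (Parallel-∷⁻ P)
  u≢v : u ≢ v
  u≢v = distinct-ends P (here refl)
  head-min : foldl applyComp x' cs u ≡ x u ∧ x v
  head-min with repeated-or-untouched P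
  ... | inj₁ m = trans (at-min IH m)
                   (trans (cong₂ _∧_ (applyComp-min x u v) (applyComp-max x u≢v)) ([a∧b]∧[a∨b]≡a∧b (x u) (x v)))
  ... | inj₂ (ut , _) = trans (elsewhere IH ut) (applyComp-min x u v)
  head-max : foldl applyComp x' cs v ≡ x u ∨ x v
  head-max with repeated-or-untouched P
  ... | inj₁ m = trans (at-max IH m)
                   (trans (cong₂ _∨_ (applyComp-min x u v) (applyComp-max x u≢v)) ([a∧b]∨[a∨b]≡a∨b (x u) (x v)))
  ... | inj₂ (_ , ut) = trans (elsewhere IH ut) (applyComp-max x u≢v)
  min-case : ∀ {u' v'} → (u' , v') ∈ (u , v) ∷ cs → foldl applyComp x' cs u' ≡ x u' ∧ x v'
  min-case (here refl) = head-min
  min-case (there m) with equal-or-disjoint P (here refl) (there m)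
  ... | inj₁ refl = head-min
  ... | inj₂ (d₁ , d₂ , d₃ , d₄) = trans (at-min IH m)
        (cong₂ _∧_ (applyComp-other x (d₁ ∘ sym) (d₃ ∘ sym)) (applyComp-other x (d₂ ∘ sym) (d₄ ∘ sym)))
  max-case : ∀ {u' v'} → (u' , v') ∈ (u , v) ∷ cs → foldl applyComp x' cs v' ≡ x u' ∨ x v'
  max-case (here refl) = head-max
  max-case (there m) with equal-or-disjoint P (here refl) (there m)
  ... | inj₁ refl = head-max
  ... | inj₂ (d₁ , d₂ , d₃ , d₄) = trans (at-max IH m)
        (cong₂ _∨_ (applyComp-other x (d₁ ∘ sym) (d₃ ∘ sym)) (applyComp-other x (d₂ ∘ sym) (d₄ ∘ sym)))
  other : ∀ {r} → Untouched ((u , v) ∷ cs) r → foldl applyComp x' cs r ≡ x r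
  other ut with ut (here refl)
  ... | r≢u , r≢v = trans (elsewhere IH (ut ∘ there)) (applyComp-other x r≢u r≢v)

Endpoint : ℕ → Comparator → Set
Endpoint r (u , v) = r ≡ u ⊎ r ≡ v

endpoint? : ∀ r c → Dec (Endpoint r c)
endpoint? r (u , v) = (r ≟ u) ⊎-dec (r ≟ v)

foldl-parallel-⇔ : ∀ {cs ds} x → Parallel cs → (∀ {c} → c ∈ cs ⇔ c ∈ ds) →
                   ∀ r → foldl applyComp x cs r ≡ foldl applyComp x ds r
foldl-parallel-⇔ {cs} {ds} x P cs⇔ds r = by-cases (any? (endpoint? r) cs)
  where
  Ecs : ParallelEffect x cs (foldl applyComp x cs)
  Ecs = foldl-parallel cs x P
  Eds : ParallelEffect x ds (foldl applyComp x ds)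
  Eds = foldl-parallel ds x (Parallel-⇔ cs⇔ds P)
  by-cases : Dec (Any (Endpoint r) cs) → foldl applyComp x cs r ≡ foldl applyComp x ds r
  by-cases (yes ∃end) with find ∃end
  ... | _ , m , inj₁ refl = trans (at-min Ecs m) (sym (at-min Eds (to cs⇔ds m)))
  ... | _ , m , inj₂ refl = trans (at-max Ecs m) (sym (at-max Eds (to cs⇔ds m)))
  by-cases (no ∄end) = trans (elsewhere Ecs untouched) (sym (elsewhere Eds (untouched ∘ from cs⇔ds)))
    where
    untouched : Untouched cs r
    untouched m = (∄end ∘ lose m ∘ inj₁) , (∄end ∘ lose m ∘ inj₂)

∈-concatMap-pair⇔ : ∀ {A B : Set} {c : B} (g h : A → B) xs →
                    c ∈ concatMap (λ i → g i ∷ h i ∷ []) xs ⇔ c ∈ map g xs ++ map h xs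
∈-concatMap-pair⇔ g h xs = mk⇔ to′ from′
  where
  to′ : ∀ {c} → c ∈ concatMap (λ i → g i ∷ h i ∷ []) xs → c ∈ map g xs ++ map h xs
  to′ m with find (∈-concatMap⁻ (λ i → g i ∷ h i ∷ []) {xs = xs} m)
  ... | _ , i∈ , here refl         = ∈-++⁺ˡ (∈-map⁺ g i∈)
  ... | _ , i∈ , there (here refl) = ∈-++⁺ʳ (map g xs) (∈-map⁺ h i∈)
  from′ : ∀ {c} → c ∈ map g xs ++ map h xs → c ∈ concatMap (λ i → g i ∷ h i ∷ []) xs
  from′ m with ∈-++⁻ (map g xs) m
  ... | inj₁ m' with _ , i∈ , refl ← ∈-map⁻ g m' = ∈-concatMap⁺ (λ i → g i ∷ h i ∷ []) (lose i∈ (here refl))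
  ... | inj₂ m' with _ , i∈ , refl ← ∈-map⁻ h m' = ∈-concatMap⁺ (λ i → g i ∷ h i ∷ []) (lose i∈ (there (here refl)))

∈-range-from-1⁻ : ∀ {e X} → e ∈ range 1 X → 1 ≤ e × e ≤ X
∈-range-from-1⁻ m with _ , i∈ , refl ← ∈-map⁻ (1 +_) m = s≤s z≤n , ∈-upTo⁻ i∈

suc-odd-or-even : ∀ r → ∃[ a ] (suc r ≡ 2 * a + 1 ⊎ suc r ≡ 2 * a + 2)
suc-odd-or-even zero = 0 , inj₁ refl
suc-odd-or-even (suc r) with suc-odd-or-even r
... | a , inj₁ eq = a , inj₂ (trans (cong suc eq) (ring a))
  where
  ring : ∀ a → suc (2 * a + 1) ≡ 2 * a + 2
  ring = solve-∀
... | a , inj₂ eq = suc a , inj₁ (trans (cong suc eq) (ring a))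
  where
  ring : ∀ a → suc (2 * a + 2) ≡ 2 * suc a + 1
  ring = solve-∀

two-sorted-step : ∀ {N} x → TwoSorted N x → ∀ r d → 1 ≤ r → r + 2 * d ≤ N → x r ≤ᴮ x (r + 2 * d)
two-sorted-step {N} x (odd , even) (suc r) d _ r+2d≤N with suc-odd-or-even r
... | a , inj₁ eq = subst₂ (λ u v → x u ≤ᴮ x v) (sym eq) (sym shift)
                      (odd a (a + d) (m≤m+n a d) (subst (_≤ N) shift r+2d≤N))
  where
  ring : ∀ a d → 2 * a + 1 + 2 * d ≡ 2 * (a + d) + 1
  ring = solve-∀
  shift : suc r + 2 * d ≡ 2 * (a + d) + 1
  shift = trans (cong (_+ 2 * d) eq) (ring a d)
... | a , inj₂ eq = subst₂ (λ u v → x u ≤ᴮ x v) (sym eq) (sym shift)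
                      (even a (a + d) (m≤m+n a d) (subst (_≤ N) shift r+2d≤N))
  where
  ring : ∀ a d → 2 * a + 2 + 2 * d ≡ 2 * (a + d) + 2
  ring = solve-∀
  shift : suc r + 2 * d ≡ 2 * (a + d) + 2
  shift = trans (cong (_+ 2 * d) eq) (ring a d)

IsColumn : ℕ → ℕ → Set
IsColumn b t = 1 ≤ t × t ≤ b

register-injective : ∀ {b t t'} l l' → IsColumn b t → IsColumn b t' →
                     t + l * b ≡ t' + l' * b → (t , l) ≡ (t' , l')
register-injective {suc b} {suc t} {suc t'} l l' (_ , s≤s t≤b) (_ , s≤s t'≤b) eq =
  cong₂ _,_ (cong suc t≡t')
            (*-cancelʳ-≡ l l' (suc b) (+-cancelˡ-≡ t _ _ (trans eq' (cong (_+ l' * suc b) (sym t≡t')))))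
  where
  eq' : t + l * suc b ≡ t' + l' * suc b
  eq' = suc-injective eq
  t≡t' : t ≡ t'
  t≡t' = begin
    t                         ≡⟨ m<n⇒m%n≡m (s≤s t≤b) ⟨
    t % suc b                 ≡⟨ [m+kn]%n≡m%n t l (suc b) ⟨
    (t + l * suc b) % suc b   ≡⟨ cong (_% suc b) eq' ⟩
    (t' + l' * suc b) % suc b ≡⟨ [m+kn]%n≡m%n t' l' (suc b) ⟩
    t' % suc b                ≡⟨ m<n⇒m%n≡m (s≤s t'≤b) ⟩
    t'                        ∎
    where open ≡-Reasoning

module Columns (n b : ℕ) where

  column : Contents → ℕ → ℕ → Bool
  column y t l = y (t + l * b)

  ColumnsSorted : Contents → Set
  ColumnsSorted y = ∀ t → IsColumn b t → Sorted n (column y t)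

  record Preserves (cs : List Comparator) : Set where
    constructor preserves
    field apply : ∀ y → ColumnsSorted y → ColumnsSorted (foldl applyComp y cs)
  open Preserves

  preserves-[] : Preserves []
  preserves-[] = preserves λ _ sorted → sorted

  preserves-++ : ∀ {cs ds} → Preserves cs → Preserves ds → Preserves (cs ++ ds)
  preserves-++ {cs} {ds} Pcs Pds = preserves λ y sorted →
    subst ColumnsSorted (sym (foldl-++ applyComp y cs ds)) (apply Pds _ (apply Pcs y sorted))

  preserves-concatMap : ∀ {A : Set} (f : A → List Comparator) xs →
                        (∀ {a} → a ∈ xs → Preserves (f a)) → Preserves (concatMap f xs)
  preserves-concatMap f []       _   = preserves-[]
  preserves-concatMap f (a ∷ xs) Pfx = preserves-++ (Pfx (here refl)) (preserves-concatMap f xs (Pfx ∘ there))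

  preserves-if : ∀ β {cs} → (T β → Preserves cs) → Preserves (if β then cs else [])
  preserves-if true  P = P _
  preserves-if false _ = preserves-[]

  preserves-⇔ : ∀ {cs ds} → Parallel cs → (∀ {c} → c ∈ cs ⇔ c ∈ ds) → Preserves ds → Preserves cs
  preserves-⇔ P cs⇔ds Pds = preserves λ y sorted t tc →
    Sorted-cong (λ l _ → sym (foldl-parallel-⇔ y P cs⇔ds (t + l * b))) (apply Pds y sorted t tc)

  rung : ℕ → ℕ → ℕ → ℕ → Comparator
  rung A B δ i = (A + i * b , B + (i + δ) * b)

  Rung : ℕ → ℕ → ℕ → Comparator → Set
  Rung A B δ c = ∃[ i ] (i + δ < n × c ≡ rung A B δ i)

  off-rungs : ∀ {cs A B δ t} l → IsColumn b t → IsColumn b A → IsColumn b B →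
              (∀ {c} → c ∈ cs → Rung A B δ c) →
              (∀ i → i + δ < n → (t , l) ≢ (A , i) × (t , l) ≢ (B , i + δ)) →
              Untouched cs (t + l * b)
  off-rungs l tc Ac Bc rungs off m with rungs m
  ... | i , i+δ<n , refl = proj₁ (off i i+δ<n) ∘ register-injective l i tc Ac
                         , proj₂ (off i i+δ<n) ∘ register-injective l _ tc Bc

  rung-distinct-ends : ∀ {A B δ u v} → IsColumn b A → IsColumn b B → A ≢ B → Rung A B δ (u , v) → u ≢ v
  rung-distinct-ends {δ = δ} Ac Bc A≢B (i , _ , refl) = A≢B ∘ ,-injectiveˡ ∘ register-injective i (i + δ) Ac Bc

  rungs-equal-or-disjoint : ∀ {A B δ c c'} → IsColumn b A → IsColumn b B → A ≢ B →
                            Rung A B δ c → Rung A B δ c' → c ≡ c' ⊎ Disjoint c c'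
  rungs-equal-or-disjoint {δ = δ} Ac Bc A≢B (i , _ , refl) (i' , _ , refl) with i ≟ i'
  ... | yes refl = inj₁ refl
  ... | no i≢i'  = inj₂
    ( i≢i' ∘ ,-injectiveʳ ∘ register-injective i i' Ac Ac
    , A≢B ∘ ,-injectiveˡ ∘ register-injective i (i' + δ) Ac Bc
    , A≢B ∘ sym ∘ ,-injectiveˡ ∘ register-injective (i + δ) i' Bc Ac
    , i≢i' ∘ +-cancelʳ-≡ δ i i' ∘ ,-injectiveʳ ∘ register-injective (i + δ) (i' + δ) Bc Bc )

  rungs-disjoint : ∀ {A B δ A' B' δ' c c'} →
    IsColumn b A → IsColumn b B → IsColumn b A' → IsColumn b B' →
    A ≢ A' → A ≢ B' → B ≢ A' → B ≢ B' → Rung A B δ c → Rung A' B' δ' c' → Disjoint c c'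
  rungs-disjoint {δ = δ} {δ' = δ'} Ac Bc A'c B'c A≢A' A≢B' B≢A' B≢B' (i , _ , refl) (i' , _ , refl) =
      A≢A' ∘ ,-injectiveˡ ∘ register-injective i i' Ac A'c
    , A≢B' ∘ ,-injectiveˡ ∘ register-injective i (i' + δ') Ac B'c
    , B≢A' ∘ ,-injectiveˡ ∘ register-injective (i + δ) i' Bc A'c
    , B≢B' ∘ ,-injectiveˡ ∘ register-injective (i + δ) (i' + δ') Bc B'c

  ladder-parallel : ∀ {cs A B δ} → IsColumn b A → IsColumn b B → A ≢ B →
                    (∀ {c} → c ∈ cs → Rung A B δ c) → Parallel cs
  ladder-parallel Ac Bc A≢B rungs = record
    { distinct-ends     = rung-distinct-ends Ac Bc A≢B ∘ rungs
    ; equal-or-disjoint = λ m m' → rungs-equal-or-disjoint Ac Bc A≢B (rungs m) (rungs m')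
    }

  two-ladders-parallel : ∀ {cs A B δ A' B' δ'} →
    IsColumn b A → IsColumn b B → IsColumn b A' → IsColumn b B' → A ≢ B → A' ≢ B' →
    A ≢ A' → A ≢ B' → B ≢ A' → B ≢ B' →
    (∀ {c} → c ∈ cs → Rung A B δ c ⊎ Rung A' B' δ' c) → Parallel cs
  two-ladders-parallel {A = A} {B} {δ} {A'} {B'} {δ'} Ac Bc A'c B'c A≢B A'≢B' A≢A' A≢B' B≢A' B≢B' rungs = record
    { distinct-ends     = [ rung-distinct-ends Ac Bc A≢B , rung-distinct-ends A'c B'c A'≢B' ]′ ∘ rungs
    ; equal-or-disjoint = λ m m' → pairs (rungs m) (rungs m')
    }
    where
    pairs : ∀ {c c'} → Rung A B δ c ⊎ Rung A' B' δ' c → Rung A B δ c' ⊎ Rung A' B' δ' c' →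
            c ≡ c' ⊎ Disjoint c c'
    pairs (inj₁ r) (inj₁ r') = rungs-equal-or-disjoint Ac Bc A≢B r r'
    pairs (inj₁ r) (inj₂ r') = inj₂ (rungs-disjoint Ac Bc A'c B'c A≢A' A≢B' B≢A' B≢B' r r')
    pairs (inj₂ r) (inj₁ r') = inj₂ (Disjoint-sym (rungs-disjoint Ac Bc A'c B'c A≢A' A≢B' B≢A' B≢B' r' r))
    pairs (inj₂ r) (inj₂ r') = rungs-equal-or-disjoint A'c B'c A'≢B' r r'

  ladder-preserves : ∀ {cs A B δ} → IsColumn b A → IsColumn b B → A ≢ B →
                     (∀ {c} → c ∈ cs ⇔ Rung A B δ c) → Preserves cs
  ladder-preserves {cs} {A} {B} {δ} Ac Bc A≢B ladder = preserves sorted-after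
    where
    sorted-after : ∀ x → ColumnsSorted x → ColumnsSorted (foldl applyComp x cs)
    sorted-after x sorted t tc
      with foldl-parallel cs x (ladder-parallel Ac Bc A≢B (to ladder)) | t ≟ A | t ≟ B
    ... | E | yes refl | _ = sorted-min-shift (sorted A Ac) (sorted B Bc)
            (λ l l+δ<n → at-min E (from ladder (l , l+δ<n , refl)))
            (λ l _ n≤l+δ → elsewhere E (off-rungs l Ac Ac Bc (to ladder) λ i i+δ<n →
               (λ eq → <⇒≱ (+-cancelʳ-< δ i l (<-≤-trans i+δ<n n≤l+δ)) (≤-reflexive (,-injectiveʳ eq)))
               , A≢B ∘ ,-injectiveˡ))
    ... | E | no t≢A | yes refl = sorted-max-shift (sorted A Ac) (sorted B Bc)
            (λ i i+δ<n → at-max E (from ladder (i , i+δ<n , refl)))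
            (λ l l<δ _ → elsewhere E (off-rungs l Bc Ac Bc (to ladder) λ i _ →
               t≢A ∘ ,-injectiveˡ
               , (λ eq → <⇒≱ l<δ (≤-trans (m≤n+m δ i) (≤-reflexive (sym (,-injectiveʳ eq)))))))
    ... | E | no t≢A | no t≢B = Sorted-cong
            (λ l _ → sym (elsewhere E (off-rungs l tc Ac Bc (to ladder) λ _ _ →
               t≢A ∘ ,-injectiveˡ , t≢B ∘ ,-injectiveˡ)))
            (sorted t tc)

  ∈-ladder⇔ : ∀ {A B δ a M c} (h : ℕ → Comparator) → M + δ ≡ n →
              (∀ i → h (a + i) ≡ rung A B δ i) →
              c ∈ map h (map (a +_) (upTo M)) ⇔ Rung A B δ c
  ∈-ladder⇔ {A} {B} {δ} {a} {M} h M+δ≡n h≡rung = mk⇔ enumerated complete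
    where
    enumerated : ∀ {c} → c ∈ map h (map (a +_) (upTo M)) → Rung A B δ c
    enumerated m with ∈-map⁻ h m
    ... | _ , m' , refl with ∈-map⁻ (a +_) m'
    ...   | i , i∈ , refl = i , subst (i + δ <_) M+δ≡n (+-monoˡ-< δ (∈-upTo⁻ i∈)) , h≡rung i
    complete : ∀ {c} → Rung A B δ c → c ∈ map h (map (a +_) (upTo M))
    complete (i , i+δ<n , refl) = subst (_∈ map h (map (a +_) (upTo M))) (h≡rung i)
      (∈-map⁺ h (∈-map⁺ (a +_) (∈-upTo⁺ (+-cancelʳ-< δ i M (subst (i + δ <_) (sym M+δ≡n) i+δ<n)))))

two-sorted⇒columns-sorted : ∀ n q x → TwoSorted (n * (2 * q)) x → Columns.ColumnsSorted n (2 * q) x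
two-sorted⇒columns-sorted n q x sorted t (1≤t , t≤b) l 2+l≤n =
  subst (λ r → x (t + l * b) ≤ᴮ x r) next-row
    (two-sorted-step x sorted (t + l * b) q (≤-trans 1≤t (m≤m+n t _)) (subst (_≤ n * b) (sym next-row) in-range))
  where
  b : ℕ
  b = 2 * q
  ring : ∀ t l b → t + l * b + b ≡ t + suc l * b
  ring = solve-∀
  next-row : t + l * b + b ≡ t + suc l * b
  next-row = ring t l b
  in-range : t + suc l * b ≤ n * b
  in-range = ≤-trans (+-monoˡ-≤ (suc l * b) t≤b) (*-monoˡ-≤ b 2+l≤n)

≤-ceilDiv : ∀ {a j} p → pm2 p * j ≤ a → j ≤ ceilDiv a p
≤-ceilDiv {a} {j} p pj≤a = begin
  j                           ≡⟨ m*n/n≡m j (pm2 p) ⟨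
  j * pm2 p / pm2 p           ≤⟨ /-monoˡ-≤ (pm2 p) (≤-trans (≤-reflexive (*-comm j (pm2 p))) (≤-trans pj≤a (m≤m+n a (p ∸ 3)))) ⟩
  (a + (p ∸ 3)) / pm2 p       ∎
  where open ≤-Reasoning

2^e≤2^[1+e]∸1 : ∀ e → 2 ^ e ≤ 2 ^ suc e ∸ 1
2^e≤2^[1+e]∸1 e = begin
  2 ^ e                       ≤⟨ m≤m+n (2 ^ e) _ ⟩
  2 ^ e + (2 ^ e + 0 ∸ 1)     ≡⟨ +-∸-assoc (2 ^ e) (≤-trans (m^n>0 2 e) (m≤m+n (2 ^ e) 0)) ⟨
  2 ^ suc e ∸ 1               ∎
  where open ≤-Reasoning

2^[k∸2]≤nN : ∀ {k} → 2 ≤ k → 2 ^ (k ∸ 2) ≤ nN k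
2^[k∸2]≤nN {suc (suc k)} (s≤s (s≤s _)) = 2^e≤2^[1+e]∸1 k

k∸s∸1≤k∸2 : ∀ {k s} → 1 ≤ s → k ∸ s ∸ 1 ≤ k ∸ 2
k∸s∸1≤k∸2 {k} {s} 1≤s = subst (_≤ k ∸ 2) (sym (∸-+-assoc k s 1)) (∸-monoʳ-≤ k (+-monoˡ-≤ 1 1≤s))

m≢m+1 : ∀ m → m ≢ m + 1
m≢m+1 m = <⇒≢ (m<m+n m (s≤s z≤n))

module Network (p k : ℕ) (3≤k : 3 ≤ k) where

  n b q : ℕ
  n = nN k
  b = bB p k
  q = ceilDiv (k ∸ 2) p

  open Columns n b public

  1≤q : 1 ≤ q
  1≤q = m≥n⇒m/n>0 (+-monoˡ-≤ (p ∸ 3) (∸-monoˡ-≤ 2 3≤k))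

  q≤b : q ≤ b
  q≤b = m≤m+n q (q + 0)

  1≤b : 1 ≤ b
  1≤b = ≤-trans 1≤q q≤b

  b∸q≡q : b ∸ q ≡ q
  b∸q≡q = trans (m+n∸m≡n q (q + 0)) (+-identityʳ q)

  b/2≡q : b / 2 ≡ q
  b/2≡q = trans (cong (_/ 2) (*-comm 2 q)) (m*n/n≡m q 2)

  2^[k∸2]≤n : 2 ^ (k ∸ 2) ≤ n
  2^[k∸2]≤n = 2^[k∸2]≤nN (≤-trans (n≤1+n 2) 3≤k)

  1≤n : 1 ≤ n
  1≤n = ≤-trans (m^n>0 2 (k ∸ 2)) 2^[k∸2]≤n

  left-column : ∀ {j} → 1 ≤ j → j ≤ q → IsColumn b j
  left-column 1≤j j≤q = 1≤j , ≤-trans j≤q q≤b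

  right-column : ∀ {j} → 1 ≤ j → IsColumn b (b ∸ j + 1)
  right-column {j} 1≤j = m≤n+m 1 (b ∸ j) , subst (b ∸ j + 1 ≤_) (m∸n+n≡m 1≤b) (+-monoˡ-≤ 1 (∸-monoʳ-≤ b 1≤j))

  q<b∸j+1 : ∀ {j} → j ≤ q → q < b ∸ j + 1
  q<b∸j+1 {j} j≤q = subst (_≤ b ∸ j + 1) (+-comm q 1) (+-monoˡ-≤ 1 (subst (_≤ b ∸ j) b∸q≡q (∸-monoʳ-≤ b j≤q)))

  first-ladder : Preserves (map (λ i → (b * i , b * i + 1)) (range 1 (n ∸ 1)))
  first-ladder = ladder-preserves (1≤b , ≤-refl) (≤-refl , 1≤b) b≢1
                   (∈-ladder⇔ _ (m∸n+n≡m 1≤n) λ i → cong₂ _,_ (ring₁ b i) (ring₂ b i))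
    where
    b≢1 : b ≢ 1
    b≢1 b≡1 = <⇒≢ (+-mono-≤ 1≤q 1≤q) (sym (trans (cong (q +_) (sym (+-identityʳ q))) b≡1))
    ring₁ : ∀ b i → b * (1 + i) ≡ b + i * b
    ring₁ = solve-∀
    ring₂ : ∀ b i → b * (1 + i) + 1 ≡ 1 + (i + 1) * b
    ring₂ = solve-∀

  second-ladder : ∀ j P → 1 ≤ j → j ≤ q → 1 ≤ P → P ≤ n →
    Preserves (map (λ i → (b * i + j , b * (i + P ∸ 1) + b ∸ j + 1)) (range 0 (n ∸ P)))
  second-ladder j (suc P) 1≤j j≤q _ 1+P≤n =
    ladder-preserves (left-column 1≤j j≤q) (right-column 1≤j) (<⇒≢ (≤-<-trans j≤q (q<b∸j+1 j≤q)))
      (∈-ladder⇔ _ length λ i → cong₂ _,_ (ring₁ b i j) (second i))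
    where
    length : suc (n ∸ suc P) + P ≡ n
    length = trans (sym (+-suc (n ∸ suc P) P)) (m∸n+n≡m 1+P≤n)
    ring₁ : ∀ b i j → b * i + j ≡ j + i * b
    ring₁ = solve-∀
    ring₂ : ∀ b x w → b * x + w + 1 ≡ w + 1 + x * b
    ring₂ = solve-∀
    second : ∀ i → b * (i + suc P ∸ 1) + b ∸ j + 1 ≡ b ∸ j + 1 + (i + P) * b
    second i rewrite +-suc i P | +-∸-assoc (b * (i + P)) (≤-trans j≤q q≤b) = ring₂ b (i + P) (b ∸ j)

  -- S interleaves the two ladders; a parallel stage may apply them one after the other.
  third-ladders : ∀ j → 1 ≤ j → j ≤ q →
    Preserves (concatMap (λ i → (b * i + j , b * i + j + 1) ∷ (b * i + b ∸ j , b * i + b ∸ j + 1) ∷ [])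
                         (range 0 (n ∸ 1)))
  third-ladders j 1≤j j≤q = preserves-⇔ parallel (∈-concatMap-pair⇔ left right rows)
    (preserves-++ (ladder-preserves Lc L+1c (m≢m+1 j) ∈-left)
                  (ladder-preserves Rc (right-column 1≤j) (m≢m+1 (b ∸ j)) ∈-right))
    where
    j≤b : j ≤ b
    j≤b = ≤-trans j≤q q≤b
    left right : ℕ → Comparator
    left  i = (b * i + j , b * i + j + 1)
    right i = (b * i + b ∸ j , b * i + b ∸ j + 1)
    rows : List ℕ
    rows = range 0 (n ∸ 1)
    length : suc (n ∸ 1) + 0 ≡ n
    length = trans (+-identityʳ _) (trans (+-comm 1 (n ∸ 1)) (m∸n+n≡m 1≤n))
    ring₁ : ∀ b i w → b * i + w ≡ w + i * b
    ring₁ = solve-∀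
    ring₂ : ∀ b i w → b * i + w + 1 ≡ w + 1 + (i + 0) * b
    ring₂ = solve-∀
    q≤b∸j : q ≤ b ∸ j
    q≤b∸j = subst (_≤ b ∸ j) b∸q≡q (∸-monoʳ-≤ b j≤q)
    Lc : IsColumn b j
    Lc = left-column 1≤j j≤q
    L+1c : IsColumn b (j + 1)
    L+1c = m≤n+m 1 j , +-mono-≤ j≤q (≤-trans 1≤q (m≤m+n q 0))
    Rc : IsColumn b (b ∸ j)
    Rc = ≤-trans 1≤q q≤b∸j , m∸n≤m b j
    ∈-left : ∀ {c} → c ∈ map left rows ⇔ Rung j (j + 1) 0 c
    ∈-left = ∈-ladder⇔ left length λ i → cong₂ _,_ (ring₁ b i j) (ring₂ b i j)
    ∈-right : ∀ {c} → c ∈ map right rows ⇔ Rung (b ∸ j) (b ∸ j + 1) 0 c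
    ∈-right = ∈-ladder⇔ right length λ i →
      subst (λ w → (w , w + 1) ≡ rung (b ∸ j) (b ∸ j + 1) 0 i) (sym (+-∸-assoc (b * i) j≤b))
            (cong₂ _,_ (ring₁ b i (b ∸ j)) (ring₂ b i (b ∸ j)))
    rungs : ∀ {c} → c ∈ concatMap (λ i → left i ∷ right i ∷ []) rows →
            Rung j (j + 1) 0 c ⊎ Rung (b ∸ j) (b ∸ j + 1) 0 c
    rungs m with ∈-++⁻ (map left rows) (to (∈-concatMap-pair⇔ left right rows) m)
    ... | inj₁ m' = inj₁ (to ∈-left m')
    ... | inj₂ m' = inj₂ (to ∈-right m')
    parallel : Parallel (concatMap (λ i → left i ∷ right i ∷ []) rows)
    parallel with m≤n⇒m<n∨m≡n j≤q
    ... | inj₁ j<q = two-ladders-parallel Lc L+1c Rc (right-column 1≤j) (m≢m+1 j) (m≢m+1 (b ∸ j))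
            (<⇒≢ j<b∸j) (<⇒≢ (<-trans j<b∸j (m<m+n (b ∸ j) (s≤s z≤n)))) (<⇒≢ j+1<b∸j)
            (<⇒≢ (<-trans j+1<b∸j (m<m+n (b ∸ j) (s≤s z≤n)))) rungs
      where
      j+1<b∸j : j + 1 < b ∸ j
      j+1<b∸j = <-≤-trans (s≤s (subst (_≤ q) (+-comm 1 j) j<q))
                         (subst (_< b ∸ j) b∸q≡q (∸-monoʳ-< j<q q≤b))
      j<b∸j : j < b ∸ j
      j<b∸j = <-trans (m<m+n j (s≤s z≤n)) j+1<b∸j
    ... | inj₂ refl = ladder-parallel Lc L+1c (m≢m+1 q) λ {c} m →
            [ id , subst (λ A → Rung A (A + 1) 0 c) b∸q≡q ]′ (rungs m)

  S-preserves : ∀ d → Preserves (S p k d)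
  S-preserves d =
    preserves-++ (preserves-if (d ≡ᵇ 1) λ _ → first-ladder) (preserves-++
      (preserves-concatMap _ (range 1 (b / 2)) λ {j} j∈ →
         preserves-concatMap _ (range 1 (k ∸ 1)) λ {s} s∈ →
           preserves-if _ λ _ →
             second-ladder j (2 ^ (k ∸ s ∸ 1)) (proj₁ (∈-range-from-1⁻ j∈))
               (subst (j ≤_) b/2≡q (proj₂ (∈-range-from-1⁻ j∈))) (m^n>0 2 (k ∸ s ∸ 1))
               (≤-trans (^-monoʳ-≤ 2 (k∸s∸1≤k∸2 (proj₁ (∈-range-from-1⁻ s∈)))) 2^[k∸2]≤n))
      (preserves-concatMap _ (range 1 k) λ {j} j∈ →
         preserves-if _ λ cond →
           third-ladders j (proj₁ (∈-range-from-1⁻ j∈)) (≤-ceilDiv p (≤ᵇ⇒≤ _ _ (proj₁ (to T-∧ cond))))))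

  stage-preserves : ∀ x → Preserves (stageT p k x)
  stage-preserves x = preserves-concatMap _ (range 0 (DD p k)) λ {i} _ →
    preserves-if ((x + p * i) ≤ᵇ DD p k) λ _ → S-preserves (x + p * i)

  initially-sorted : ∀ x → TwoSorted (NN p k) x → ColumnsSorted x
  initially-sorted = two-sorted⇒columns-sorted n q

  run-preserves : ∀ m y → ColumnsSorted y → ColumnsSorted (run p k m y)
  run-preserves zero    y sorted = sorted
  run-preserves (suc m) y sorted = Preserves.apply (stage-preserves (cyc p m)) _ (run-preserves m y sorted)

lemma3p5 : (p k : ℕ) → 4 ≤ p → p ≤ k →
           (x : Contents) → TwoSorted (NN p k) x →
           (m : ℕ) → 1 ≤ m →
           (t : ℕ) → 1 ≤ t → t ≤ bB p k →
           ColumnZerosOnes (nN k) (bB p k) (run p k m x) t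
lemma3p5 p k 4≤p p≤k x two-sorted m _ t 1≤t t≤b =
  sorted⇒zeros-then-ones n (column (run p k m x) t)
    (run-preserves m x (initially-sorted x two-sorted) t (1≤t , t≤b))
  where
  open Network p k (≤-trans (n≤1+n 3) (≤-trans 4≤p p≤k))
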